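{- Let $x$ and $y$ be sequences over an alphabet $\Sigma$, let $n = |x| + |y| \ge 2$, and let $L$ be a longest common subsequence of $x$ and $y$. Then for some $f \in \{2^i \mid i \in \{0, 1, \dots, \lfloor \log n \rfloor\}\}$ we have \[ |\mathsf{Project}(L, \Sigma_{[f..2f)}(L))| \ge \frac{|L|}{2 \log n}. \]
   Context: For a sequence $z$ and a symbol $\sigma$, $\#_\sigma(z)$ is the number of indices $i$ with $z_i = \sigma$. For integers $a \le b$, $[a..b] = \{a, a+1, \dots, b\}$ (and $[f..2f)$ denotes $\{f, f+1, \dots, 2f-1\}$), and $\Sigma_{[a..b]}(z) = \{\sigma \in \Sigma \mid \#_\sigma(z) \in [a..b]\}$, with $\Sigma_{[f..2f)}(z)$ defined analogously. For a sequence $z$ and a set of symbols $\pi$, $\mathsf{Project}(z, \pi)$ is the subsequence of $z$ consisting only of the entries whose symbol lies in $\pi$. A longest common subsequence of $x$ and $y$ is a sequence of maximum length that is a subsequence of both $x$ and $y$. Logarithms are base 2. -}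

module Defs where

open import Data.Nat using (ℕ; zero; suc; _+_; _*_; _≤_; _<_; _≤?_; _<?_)
open import Data.List using (List; []; _∷_; length; filter)
open import Data.List.Relation.Binary.Sublist.Propositional using (_⊆_)
open import Data.Product using (_×_)
open import Relation.Binary.Definitions using (DecidableEquality)
open import Relation.Nullary using (yes; no)
open import Relation.Nullary.Decidable using (_×-dec_)

module _ {Σ : Set} (_≟_ : DecidableEquality Σ) where

  count# : Σ → List Σ → ℕ
  count# σ [] = 0
  count# σ (a ∷ z) with a ≟ σ
  ... | yes _ = suc (count# σ z)
  ... | no  _ = count# σ z

  -- Project(z, Σ_[f..2f)(w)): entries of z whose symbol σ has #_σ(w) ∈ [f..2f)
  ProjectFreq : ℕ → List Σ → List Σ → List Σ
  ProjectFreq f w z =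
    filter (λ σ → (f ≤? count# σ w) ×-dec (count# σ w <? 2 * f)) z

IsCommonSubseq : {Σ : Set} → List Σ → List Σ → List Σ → Set
IsCommonSubseq z x y = (z ⊆ x) × (z ⊆ y)

IsLCS : {Σ : Set} → List Σ → List Σ → List Σ → Set
IsLCS {Σ} L x y =
  IsCommonSubseq L x y × ((z : List Σ) → IsCommonSubseq z x y → length z ≤ length L)

-- Every symbol occurring in L has a frequency in [1..|L|], so it lies in one of the
-- ⌊log n⌋ + 1 dyadic frequency bands [2^i..2^(i+1)).  These bands cover L, hence the
-- largest one carries at least |L| / (⌊log n⌋ + 1) ≥ |L| / (2 ⌊log n⌋) entries of L.
-- Without real logarithms the bound is stated as 2^|L| ≤ n^(2p), which follows from
-- |L| ≤ 2p ⌊log n⌋ and 2^⌊log n⌋ ≤ n.  Nothing about L beyond |L| ≤ n is needed.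
module Submission where

open import Defs
open import Data.Bool using (true; false)
open import Data.List using (List; []; _∷_; length; filter)
open import Data.List.Membership.Propositional using (_∈_)
open import Data.List.Properties using (filter-accept)
open import Data.List.Relation.Binary.Sublist.Propositional.Properties using (length-mono-≤)
open import Data.List.Relation.Unary.All using (All; []; _∷_; tabulate)
open import Data.List.Relation.Unary.Any using (here; there)
open import Data.Nat using (ℕ; zero; suc; _+_; _*_; _^_; _≤_; _<_; _≤?_; _<?_; z≤n; s≤s; s≤s⁻¹; ⌊_/2⌋; NonZero; >-nonZero)
open import Data.Nat.Induction using (<-wellFounded)
open import Data.Nat.Logarithm using (⌊log₂_⌋; ⌊log₂⌋-mono-≤; ⌊log₂[2^n]⌋≡n)
open import Data.Nat.Logarithm.Core using (⌊log2⌋)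
open import Data.Nat.Properties
open import Data.Nat.Tactic.RingSolver using (solve-∀)
open import Data.Product using (_×_; _,_; proj₁; proj₂; ∃-syntax)
open import Data.Sum using (inj₁; inj₂)
open import Induction.WellFounded using (Acc; acc)
open import Level using (0ℓ)
open import Relation.Binary.Definitions using (DecidableEquality)
open import Relation.Binary.PropositionalEquality using (_≡_; refl; sym; cong)
open import Relation.Nullary using (does; yes; no; contradiction)
open import Relation.Nullary.Decidable using (_×-dec_)
open import Relation.Unary using (Pred; Decidable)

2*⌊n/2⌋≤n : ∀ n → 2 * ⌊ n /2⌋ ≤ n
2*⌊n/2⌋≤n 0             = z≤n
2*⌊n/2⌋≤n 1             = z≤n
2*⌊n/2⌋≤n (suc (suc n)) = begin
  2 * suc ⌊ n /2⌋ ≡⟨ *-suc 2 ⌊ n /2⌋ ⟩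
  2 + 2 * ⌊ n /2⌋ ≤⟨ +-monoʳ-≤ 2 (2*⌊n/2⌋≤n n) ⟩
  2 + n           ∎
  where open ≤-Reasoning

n<2*[1+⌊n/2⌋] : ∀ n → n < 2 * suc ⌊ n /2⌋
n<2*[1+⌊n/2⌋] 0             = s≤s z≤n
n<2*[1+⌊n/2⌋] 1             = s≤s (s≤s z≤n)
n<2*[1+⌊n/2⌋] (suc (suc n)) = begin-strict
  2 + n                 <⟨ +-monoʳ-< 2 (n<2*[1+⌊n/2⌋] n) ⟩
  2 + 2 * suc ⌊ n /2⌋   ≡⟨ *-suc 2 (suc ⌊ n /2⌋) ⟨
  2 * suc (suc ⌊ n /2⌋) ∎
  where open ≤-Reasoning

-- Recursing on the accessibility proof makes each step of ⌊log2⌋ reduce definitionally.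
2^⌊log2⌋-bounds : ∀ n .{{_ : NonZero n}} (rec : Acc _<_ n) →
  2 ^ ⌊log2⌋ n rec ≤ n × n < 2 ^ suc (⌊log2⌋ n rec)
2^⌊log2⌋-bounds 1 _ = ≤-refl , s≤s (s≤s z≤n)
2^⌊log2⌋-bounds (suc (suc n)) (acc rs)
  with lo , hi ← 2^⌊log2⌋-bounds (suc ⌊ n /2⌋) (rs (⌊n/2⌋<n (suc n))) =
    ≤-trans (*-monoʳ-≤ 2 lo) (2*⌊n/2⌋≤n (2 + n))
  , <-≤-trans (n<2*[1+⌊n/2⌋] (2 + n)) (*-monoʳ-≤ 2 hi)

2^⌊log₂n⌋≤n : ∀ n .{{_ : NonZero n}} → 2 ^ ⌊log₂ n ⌋ ≤ n
2^⌊log₂n⌋≤n n = proj₁ (2^⌊log2⌋-bounds n (<-wellFounded n))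

n<2^[1+⌊log₂n⌋] : ∀ n .{{_ : NonZero n}} → n < 2 ^ suc ⌊log₂ n ⌋
n<2^[1+⌊log₂n⌋] n = proj₂ (2^⌊log2⌋-bounds n (<-wellFounded n))

a≤⌊log₂n⌋*m⇒2^a≤n^m : ∀ {a m} n .{{_ : NonZero n}} → a ≤ ⌊log₂ n ⌋ * m → 2 ^ a ≤ n ^ m
a≤⌊log₂n⌋*m⇒2^a≤n^m {a} {m} n a≤Km = begin
  2 ^ a                ≤⟨ ^-monoʳ-≤ 2 a≤Km ⟩
  2 ^ (⌊log₂ n ⌋ * m)  ≡⟨ ^-*-assoc 2 ⌊log₂ n ⌋ m ⟨
  (2 ^ ⌊log₂ n ⌋) ^ m  ≤⟨ ^-monoˡ-≤ m (2^⌊log₂n⌋≤n n) ⟩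
  n ^ m                ∎
  where open ≤-Reasoning

∑< : ℕ → (ℕ → ℕ) → ℕ
∑< zero    f = 0
∑< (suc k) f = ∑< k f + f k

syntax ∑< k (λ i → e) = ∑[ i < k ] e

∑<-mono-≤ : ∀ {f g} → (∀ i → f i ≤ g i) → ∀ k → ∑< k f ≤ ∑< k g
∑<-mono-≤ f≤g zero    = z≤n
∑<-mono-≤ f≤g (suc k) = +-mono-≤ (∑<-mono-≤ f≤g k) (f≤g k)

∑<-mono-< : ∀ {f g j k} → (∀ i → f i ≤ g i) → j < k → f j < g j → ∑< k f < ∑< k g
∑<-mono-< {k = suc k} f≤g j<1+k fj<gj with m≤n⇒m<n∨m≡n (s≤s⁻¹ j<1+k)
... | inj₁ j<k  = +-mono-<-≤ (∑<-mono-< f≤g j<k fj<gj) (f≤g k)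
... | inj₂ refl = +-mono-≤-< (∑<-mono-≤ f≤g k) fj<gj

∃-term-≥-mean : ∀ k f → ∃[ i ] (i ≤ k × ∑< (suc k) f ≤ suc k * f i)
∃-term-≥-mean zero    f = 0 , z≤n , ≤-reflexive (+-comm 0 (f 0))
∃-term-≥-mean (suc k) f with i , i≤k , mean ← ∃-term-≥-mean k f | f (suc k) ≤? f i
... | yes fk≤fi = i , m≤n⇒m≤1+n i≤k , (begin
  ∑< (suc k) f + f (suc k) ≤⟨ +-mono-≤ mean fk≤fi ⟩
  suc k * f i + f i        ≡⟨ +-comm (suc k * f i) (f i) ⟩
  suc (suc k) * f i        ∎)
  where open ≤-Reasoning
... | no fk≰fi = suc k , ≤-refl , (begin
  ∑< (suc k) f + f (suc k)      ≤⟨ +-monoˡ-≤ (f (suc k)) (≤-trans mean (*-monoʳ-≤ (suc k) fi≤fk)) ⟩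
  suc k * f (suc k) + f (suc k) ≡⟨ +-comm (suc k * f (suc k)) (f (suc k)) ⟩
  suc (suc k) * f (suc k)       ∎)
  where
  open ≤-Reasoning
  fi≤fk : f i ≤ f (suc k)
  fi≤fk = <⇒≤ (≰⇒> fk≰fi)

module _ {A : Set} {P : ℕ → Pred A 0ℓ} (P? : ∀ i → Decidable (P i)) where

  length-filter-≤-∷ : ∀ i a xs → length (filter (P? i) xs) ≤ length (filter (P? i) (a ∷ xs))
  length-filter-≤-∷ i a xs with does (P? i a)
  ... | true  = n≤1+n _
  ... | false = ≤-refl

  length≤∑length-filter : ∀ k {xs} → All (λ a → ∃[ i ] (i < k × P i a)) xs →
    length xs ≤ ∑[ i < k ] length (filter (P? i) xs)
  length≤∑length-filter k []                                 = z≤n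
  length≤∑length-filter k {a ∷ xs} ((j , j<k , Pja) ∷ cover) = begin-strict
    length xs                                  ≤⟨ length≤∑length-filter k cover ⟩
    ∑[ i < k ] length (filter (P? i) xs)       <⟨ ∑<-mono-< (λ i → length-filter-≤-∷ i a xs) j<k a-counted ⟩
    ∑[ i < k ] length (filter (P? i) (a ∷ xs)) ∎
    where
    open ≤-Reasoning
    a-counted : length (filter (P? j) xs) < length (filter (P? j) (a ∷ xs))
    a-counted = ≤-reflexive (sym (cong length (filter-accept (P? j) {xs = xs} Pja)))

module _ {Σ : Set} (_≟_ : DecidableEquality Σ) where

  count#≤length : ∀ σ w → count# _≟_ σ w ≤ length w
  count#≤length σ []      = z≤n
  count#≤length σ (a ∷ w) with a ≟ σ
  ... | yes _ = s≤s (count#≤length σ w)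
  ... | no  _ = m≤n⇒m≤1+n (count#≤length σ w)

  count#-pos : ∀ {σ w} → σ ∈ w → 0 < count# _≟_ σ w
  count#-pos {σ} {a ∷ w} σ∈a∷w with a ≟ σ | σ∈a∷w
  ... | yes _  | _          = s≤s z≤n
  ... | no a≢σ | here σ≡a   = contradiction (sym σ≡a) a≢σ
  ... | no _   | there σ∈w  = count#-pos σ∈w

  -- inBand? f w is the test ProjectFreq filters with: ProjectFreq _≟_ f w is filter (inBand? f w).
  InBand : ℕ → List Σ → Pred Σ 0ℓ
  InBand f w σ = f ≤ count# _≟_ σ w × count# _≟_ σ w < 2 * f

  inBand? : ∀ f w → Decidable (InBand f w)
  inBand? f w σ = (f ≤? count# _≟_ σ w) ×-dec (count# _≟_ σ w <? 2 * f)

  length≤∑length-ProjectFreq : ∀ {w n} → length w ≤ n →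
    length w ≤ ∑[ i < suc ⌊log₂ n ⌋ ] length (ProjectFreq _≟_ (2 ^ i) w w)
  length≤∑length-ProjectFreq {w} {n} |w|≤n =
    length≤∑length-filter (λ i → inBand? (2 ^ i) w) (suc ⌊log₂ n ⌋) (tabulate band)
    where
    band : ∀ {σ} → σ ∈ w → ∃[ i ] (i < suc ⌊log₂ n ⌋ × InBand (2 ^ i) w σ)
    band {σ} σ∈w =
      ⌊log₂ c ⌋ , s≤s (⌊log₂⌋-mono-≤ (≤-trans (count#≤length σ w) |w|≤n)) ,
      2^⌊log₂n⌋≤n c , n<2^[1+⌊log₂n⌋] c
      where
      c : ℕ
      c = count# _≟_ σ w
      instance
        c-nonZero : NonZero c
        c-nonZero = >-nonZero (count#-pos σ∈w)

  ∃-heavy-frequency-band : ∀ {w n} → 2 ≤ n → length w ≤ n →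
    ∃[ i ] (i ≤ ⌊log₂ n ⌋ × length w ≤ ⌊log₂ n ⌋ * (2 * length (ProjectFreq _≟_ (2 ^ i) w w)))
  ∃-heavy-frequency-band {w} {n} 2≤n |w|≤n
    with i , i≤K , mean ← ∃-term-≥-mean ⌊log₂ n ⌋ (λ i → length (ProjectFreq _≟_ (2 ^ i) w w)) =
    i , i≤K , (begin
      length w      ≤⟨ length≤∑length-ProjectFreq {w} |w|≤n ⟩
      ∑< (suc K) p  ≤⟨ mean ⟩
      suc K * p i   ≤⟨ *-monoˡ-≤ (p i) (+-monoˡ-≤ K 1≤K) ⟩
      (K + K) * p i ≡⟨ double K (p i) ⟩
      K * (2 * p i) ∎)
    where
    open ≤-Reasoning
    K : ℕ
    K = ⌊log₂ n ⌋
    p : ℕ → ℕ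
    p i = length (ProjectFreq _≟_ (2 ^ i) w w)
    1≤K : 1 ≤ K
    1≤K = ≤-trans (≤-reflexive (sym (⌊log₂[2^n]⌋≡n 1))) (⌊log₂⌋-mono-≤ 2≤n)
    double : ∀ a b → (a + a) * b ≡ a * (2 * b)
    double = solve-∀

lemma7 : {Σ : Set} (_≟_ : DecidableEquality Σ) (x y L : List Σ) →
    2 ≤ length x + length y →
    IsLCS L x y →
    ∃[ i ] (i ≤ ⌊log₂ (length x + length y) ⌋ ×
      2 ^ length L ≤ (length x + length y) ^ (2 * length (ProjectFreq _≟_ (2 ^ i) L L)))
lemma7 _≟_ x y L 2≤n ((L⊆x , _) , _) =
  let i , i≤K , |L|≤K*2p = ∃-heavy-frequency-band _≟_ {L} 2≤n |L|≤n
  in  i , i≤K , a≤⌊log₂n⌋*m⇒2^a≤n^m (length x + length y) {{>-nonZero 0<n}} |L|≤K*2p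
  where
  0<n : 0 < length x + length y
  0<n = ≤-trans (n≤1+n 1) 2≤n
  |L|≤n : length L ≤ length x + length y
  |L|≤n = ≤-trans (length-mono-≤ L⊆x) (m≤m+n (length x) (length y))
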